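{- Let $\mathcal{V}\subseteq\mathbb{F}_2^n$ be a subspace, $\pi_i=a_i+\mathcal{V}$ for $i\in[3]$, and $E_1,E_2,E_3\subseteq\mathbb{F}_2^n$. Let $G$ be the bipartite graph with edge set $E(G)=\{(x,y): x\in E_1\cap\pi_1,\ y\in E_2\cap\pi_2,\ x+y\in E_3\cap\pi_3\}$. Let $b=\{x_0,x_1\}\times\{y_0,y_1\}\subseteq E(G)$ be a bow tie, and let $I\subseteq[n]$ be the set of coordinates $i$ with $x_0(i)\ne x_1(i)$. Then $\mathsf{val}^{(i)}(\mathcal{G}|\tilde b)\le 3/4$ for all $i\in I$.
   Context: A bow tie is a set of edges $b=\{x_0,x_1\}\times\{y_0,y_1\}\subseteq E(G)$ with $x_0\ne x_1\in\pi_1$, $y_0\ne y_1\in\pi_2$ and $x_0+y_0=x_1+y_1$. $\tilde b$ denotes the uniform distribution on $\{(x_i,y_j,x_i+y_j): i,j\in\{0,1\}\}\subseteq(\mathbb{F}_2^n)^3$. $\mathcal{G}$ is the $n$-fold parallel repetition of the GHZ game: player $j\in[3]$ receives $x_j\in\mathbb{F}_2^n$ and outputs $y_j\in\mathbb{F}_2^n$ as a function of $x_j$ only; they win in coordinate $i$ iff $y_1(i)+y_2(i)+y_3(i)\equiv x_1(i)\lor x_2(i)\lor x_3(i)\pmod 2$. For a distribution $D$ on $(\mathbb{F}_2^n)^3$, $\mathsf{val}^{(i)}(\mathcal{G}|D)$ is the maximum over deterministic strategies $\bar f_1\times\bar f_2\times\bar f_3$ (with $\bar f_j:\mathbb{F}_2^n\to\mathbb{F}_2^n$)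 of the probability, for queries drawn from $D$, of winning in coordinate $i$. -}

module Defs where

open import Data.Bool using (Bool; true; false; _xor_; _∨_; if_then_else_)
open import Data.Nat using (ℕ; zero; suc; _+_)
open import Data.Fin using (Fin)
open import Data.Vec using (Vec; zipWith; replicate; lookup)
open import Data.List using (List; []; _∷_; length)
open import Data.Product using (_×_; _,_)
open import Data.Integer using (+_)
open import Data.Rational using (ℚ; _/_)
open import Relation.Binary.PropositionalEquality using (_≡_; _≢_)

F2ⁿ : ℕ → Set
F2ⁿ n = Vec Bool n

_⊕_ : ∀ {n} → F2ⁿ n → F2ⁿ n → F2ⁿ n
_⊕_ = zipWith _xor_

𝟎 : ∀ {n} → F2ⁿ n
𝟎 = replicate _ false

Subset : ℕ → Set₁
Subset n = F2ⁿ n → Set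

-- a (linear) subspace of 𝔽₂ⁿ: contains 0 and closed under addition
-- (over 𝔽₂ scalar multiplication is automatic)
record IsSubspace {n : ℕ} (V : Subset n) : Set where
  field
    zero∈ : V 𝟎
    +-closed : ∀ x y → V x → V y → V (x ⊕ y)

Coset : ∀ {n} → F2ⁿ n → Subset n → Subset n
Coset a V x = V (x ⊕ a)

Edge : ∀ {n} (V : Subset n) (a₁ a₂ a₃ : F2ⁿ n) (E₁ E₂ E₃ : Subset n) →
       F2ⁿ n → F2ⁿ n → Set
Edge V a₁ a₂ a₃ E₁ E₂ E₃ x y =
  (E₁ x × Coset a₁ V x) × (E₂ y × Coset a₂ V y) × (E₃ (x ⊕ y) × Coset a₃ V (x ⊕ y))

IsBowTie : ∀ {n} (V : Subset n) (a₁ a₂ a₃ : F2ⁿ n) (E₁ E₂ E₃ : Subset n) →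
           (x₀ x₁ y₀ y₁ : F2ⁿ n) → Set
IsBowTie V a₁ a₂ a₃ E₁ E₂ E₃ x₀ x₁ y₀ y₁ =
  x₀ ≢ x₁ × y₀ ≢ y₁ × (x₀ ⊕ y₀) ≡ (x₁ ⊕ y₁) ×
  Edge V a₁ a₂ a₃ E₁ E₂ E₃ x₀ y₀ × Edge V a₁ a₂ a₃ E₁ E₂ E₃ x₀ y₁ ×
  Edge V a₁ a₂ a₃ E₁ E₂ E₃ x₁ y₀ × Edge V a₁ a₂ a₃ E₁ E₂ E₃ x₁ y₁

Query : ℕ → Set
Query n = F2ⁿ n × F2ⁿ n × F2ⁿ n

Strategy : ℕ → Set
Strategy n = F2ⁿ n → F2ⁿ n

winsAt : ∀ {n} → Fin n → Strategy n → Strategy n → Strategy n → Query n → Bool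
winsAt i f₁ f₂ f₃ (x₁ , x₂ , x₃) =
  isEq ((lookup (f₁ x₁) i xor lookup (f₂ x₂) i) xor lookup (f₃ x₃) i)
       ((lookup x₁ i ∨ lookup x₂ i) ∨ lookup x₃ i)
  where
  isEq : Bool → Bool → Bool
  isEq a b = if a xor b then false else true

-- b̃ : uniform distribution on the four points (x_i, y_j, x_i + y_j)
bowTieDist : ∀ {n} → (x₀ x₁ y₀ y₁ : F2ⁿ n) → List (Query n)
bowTieDist x₀ x₁ y₀ y₁ =
  (x₀ , y₀ , x₀ ⊕ y₀) ∷ (x₀ , y₁ , x₀ ⊕ y₁) ∷
  (x₁ , y₀ , x₁ ⊕ y₀) ∷ (x₁ , y₁ , x₁ ⊕ y₁) ∷ []

countWins : ∀ {n} → Fin n → Strategy n → Strategy n → Strategy n → List (Query n) → ℕ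
countWins i f₁ f₂ f₃ [] = 0
countWins i f₁ f₂ f₃ (q ∷ qs) =
  (if winsAt i f₁ f₂ f₃ q then 1 else 0) + countWins i f₁ f₂ f₃ qs

winProb4 : ∀ {n} → Fin n → Strategy n → Strategy n → Strategy n → List (Query n) → ℚ
winProb4 i f₁ f₂ f₃ qs = (+ countWins i f₁ f₂ f₃ qs) / 4

-- In one coordinate i the four queries of a bow tie are, bitwise, (a , b , a xor b) with a and b
-- ranging over both bit values: x₀ and x₁ differ at i by assumption, and then so do y₀ and y₁
-- since x₀ + y₀ = x₁ + y₁. For these four GHZ questions the OR is 1 exactly three times, so the
-- four winning conditions  u + v + w = a ∨ b ∨ c  have right-hand sides summing to 1 mod 2.
-- On the left every answer bit occurs twice, player 3 being asked x₀ + y₀ = x₁ + y₁ twice and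
-- x₀ + y₁ = x₁ + y₀ twice, so the left-hand sides sum to 0. Hence some query is lost.
module Submission where

open import Defs
open import Data.Nat using (ℕ)
open import Data.Fin using (Fin)
open import Data.Vec using (lookup)
open import Data.Integer using (+_)
open import Data.Rational using (_≤_; _/_)
open import Relation.Binary.PropositionalEquality using (_≢_)

open import Algebra.Bundles using (CommutativeRing)
open import Data.Bool using (Bool; true; false; not; _xor_; _∨_; if_then_else_)
open import Data.Bool.Properties using (xor-same; xor-∧-commutativeRing; not-involutive)
open import Data.List using (List; []; _∷_; map; foldr; length)
open import Data.List.Properties using (map-cong-local)
open import Data.List.Relation.Unary.All as All using (All; []; _∷_)
import Data.Nat as ℕ
import Data.Nat.Properties as ℕ
open import Data.Product using (_,_)
import Data.Rational.Properties as ℚ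
open import Data.Vec using ([]; _∷_)
open import Data.Vec.Properties using (lookup-zipWith; ∷-injective)
open import Data.Empty using (⊥-elim)
open import Function using (_∘_)
open import Relation.Binary.PropositionalEquality
  using (_≡_; refl; sym; trans; cong; cong₂; subst)
open import Relation.Nullary using (¬_)
open import Relation.Nullary.Decidable using (True; toWitness)
open import Algebra.Solver.CommutativeMonoid (CommutativeRing.+-commutativeMonoid xor-∧-commutativeRing)
  using (solve; _⊜_; id) renaming (_⊕_ to _⊞_)

parity : List Bool → Bool
parity = foldr _xor_ false

xnor : Bool → Bool → Bool
xnor a b = if a xor b then false else true

xnor≡true⇒≡ : ∀ a b → xnor a b ≡ true → a ≡ b
xnor≡true⇒≡ false false _ = refl
xnor≡true⇒≡ true  true  _ = refl
xnor≡true⇒≡ false true  ()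
xnor≡true⇒≡ true  false ()

xor-swap : ∀ a b c d → a xor c ≡ b xor d → b xor c ≡ a xor d
xor-swap false false c d eq = eq
xor-swap true  true  c d eq = eq
xor-swap false true  c d eq = trans (cong not eq) (not-involutive d)
xor-swap true  false c d eq = trans (sym (not-involutive c)) (cong not eq)

⊕-swap : ∀ {n} {x₀ x₁ y₀ y₁ : F2ⁿ n} → x₀ ⊕ y₀ ≡ x₁ ⊕ y₁ → x₁ ⊕ y₀ ≡ x₀ ⊕ y₁
⊕-swap {x₀ = []} {[]} {[]} {[]} _ = refl
⊕-swap {x₀ = a ∷ x₀} {b ∷ x₁} {c ∷ y₀} {d ∷ y₁} eq =
  let (eqʰ , eqᵗ) = ∷-injective eq in cong₂ _∷_ (xor-swap a b c d eqʰ) (⊕-swap eqᵗ)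

parity-pairedAnswers : ∀ u₀ u₁ v₀ v₁ w w′ →
  parity (((u₀ xor v₀) xor w) ∷ ((u₀ xor v₁) xor w′) ∷ ((u₁ xor v₀) xor w′) ∷ ((u₁ xor v₁) xor w) ∷ [])
    ≡ false
parity-pairedAnswers u₀ u₁ v₀ v₁ w w′ = trans pairUp selfCancel
  where
  pairUp : parity (((u₀ xor v₀) xor w) ∷ ((u₀ xor v₁) xor w′) ∷ ((u₁ xor v₀) xor w′) ∷ ((u₁ xor v₁) xor w) ∷ [])
         ≡ (u₀ xor u₀) xor ((u₁ xor u₁) xor ((v₀ xor v₀) xor ((v₁ xor v₁) xor ((w xor w) xor (w′ xor w′)))))
  pairUp = solve 6 (λ u₀ u₁ v₀ v₁ w w′ →
      ((u₀ ⊞ v₀) ⊞ w) ⊞ (((u₀ ⊞ v₁) ⊞ w′) ⊞ (((u₁ ⊞ v₀) ⊞ w′) ⊞ (((u₁ ⊞ v₁) ⊞ w) ⊞ id)))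
    ⊜ (u₀ ⊞ u₀) ⊞ ((u₁ ⊞ u₁) ⊞ ((v₀ ⊞ v₀) ⊞ ((v₁ ⊞ v₁) ⊞ ((w ⊞ w) ⊞ (w′ ⊞ w′))))))
    refl u₀ u₁ v₀ v₁ w w′
  selfCancel : (u₀ xor u₀) xor ((u₁ xor u₁) xor ((v₀ xor v₀) xor ((v₁ xor v₁) xor ((w xor w) xor (w′ xor w′)))))
             ≡ false
  selfCancel rewrite xor-same u₀ | xor-same u₁ | xor-same v₀ | xor-same v₁ | xor-same w | xor-same w′ = refl

parity-ghzQuestions : ∀ a₀ a₁ b₀ b₁ → a₀ ≢ a₁ → a₀ xor b₀ ≡ a₁ xor b₁ →
  parity (((a₀ ∨ b₀) ∨ (a₀ xor b₀)) ∷ ((a₀ ∨ b₁) ∨ (a₀ xor b₁)) ∷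
          ((a₁ ∨ b₀) ∨ (a₁ xor b₀)) ∷ ((a₁ ∨ b₁) ∨ (a₁ xor b₁)) ∷ [])
    ≡ true
parity-ghzQuestions false false _     _     a₀≢a₁ _ = ⊥-elim (a₀≢a₁ refl)
parity-ghzQuestions true  true  _     _     a₀≢a₁ _ = ⊥-elim (a₀≢a₁ refl)
parity-ghzQuestions false true  false true  _     _ = refl
parity-ghzQuestions false true  true  false _     _ = refl
parity-ghzQuestions true  false false true  _     _ = refl
parity-ghzQuestions true  false true  false _     _ = refl
parity-ghzQuestions false true  false false _     ()
parity-ghzQuestions false true  true  true  _     ()
parity-ghzQuestions true  false false false _     ()
parity-ghzQuestions true  false true  true  _     ()

lookup-⊕ : ∀ {n} (x y : F2ⁿ n) (i : Fin n) → lookup (x ⊕ y) i ≡ lookup x i xor lookup y i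
lookup-⊕ x y i = lookup-zipWith _xor_ i x y

module _ {n : ℕ} (i : Fin n) (f₁ f₂ f₃ : Strategy n) where

  answerXor : Query n → Bool
  answerXor (x , y , z) = (lookup (f₁ x) i xor lookup (f₂ y) i) xor lookup (f₃ z) i

  questionOr : Query n → Bool
  questionOr (x , y , z) = (lookup x i ∨ lookup y i) ∨ lookup z i

  Wins : Query n → Set
  Wins q = winsAt i f₁ f₂ f₃ q ≡ true

  wins⇒answerXor≡questionOr : ∀ {q} → Wins q → answerXor q ≡ questionOr q
  wins⇒answerXor≡questionOr {x , y , z} = xnor≡true⇒≡ _ _

  countWins≤length : ∀ qs → countWins i f₁ f₂ f₃ qs ℕ.≤ length qs
  countWins≤length [] = ℕ.z≤n
  countWins≤length (q ∷ qs) with winsAt i f₁ f₂ f₃ q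
  ... | true  = ℕ.s≤s (countWins≤length qs)
  ... | false = ℕ.m≤n⇒m≤1+n (countWins≤length qs)

  countWins≡length⇒allWin : ∀ qs → countWins i f₁ f₂ f₃ qs ≡ length qs → All Wins qs
  countWins≡length⇒allWin [] _ = []
  countWins≡length⇒allWin (q ∷ qs) eq with winsAt i f₁ f₂ f₃ q in wins
  ... | true  = wins ∷ countWins≡length⇒allWin qs (ℕ.suc-injective eq)
  ... | false = ⊥-elim (ℕ.1+n≰n (subst (ℕ._≤ length qs) eq (countWins≤length qs)))

  allWin⇒parity≡ : ∀ {qs} → All Wins qs → parity (map answerXor qs) ≡ parity (map questionOr qs)
  allWin⇒parity≡ allWin = cong parity (map-cong-local (All.map wins⇒answerXor≡questionOr allWin))

  module _ {x₀ x₁ y₀ y₁ : F2ⁿ n} (sum≡ : x₀ ⊕ y₀ ≡ x₁ ⊕ y₁) where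

    parity-bowTieAnswers : parity (map answerXor (bowTieDist x₀ x₁ y₀ y₁)) ≡ false
    parity-bowTieAnswers rewrite sym sum≡ | ⊕-swap sum≡ =
      parity-pairedAnswers (bit (f₁ x₀)) (bit (f₁ x₁)) (bit (f₂ y₀)) (bit (f₂ y₁))
                           (bit (f₃ (x₀ ⊕ y₀))) (bit (f₃ (x₀ ⊕ y₁)))
      where
      bit : F2ⁿ n → Bool
      bit v = lookup v i

    parity-bowTieQuestions : lookup x₀ i ≢ lookup x₁ i →
      parity (map questionOr (bowTieDist x₀ x₁ y₀ y₁)) ≡ true
    parity-bowTieQuestions x₀≢x₁
      rewrite lookup-⊕ x₀ y₀ i | lookup-⊕ x₀ y₁ i | lookup-⊕ x₁ y₀ i | lookup-⊕ x₁ y₁ i =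
      parity-ghzQuestions _ _ _ _ x₀≢x₁ sum≡ᵢ
      where
      sum≡ᵢ : lookup x₀ i xor lookup y₀ i ≡ lookup x₁ i xor lookup y₁ i
      sum≡ᵢ = trans (sym (lookup-⊕ x₀ y₀ i)) (trans (cong (λ v → lookup v i) sum≡) (lookup-⊕ x₁ y₁ i))

    bowTie-¬allWin : lookup x₀ i ≢ lookup x₁ i → ¬ All Wins (bowTieDist x₀ x₁ y₀ y₁)
    bowTie-¬allWin x₀≢x₁ allWin
      with trans (sym parity-bowTieAnswers) (trans (allWin⇒parity≡ allWin) (parity-bowTieQuestions x₀≢x₁))
    ... | ()

k/4≤3/4 : ∀ {k} → k ℕ.≤ 3 → (+ k) / 4 ≤ (+ 3) / 4
k/4≤3/4 k≤3 = toWitness (decided k≤3)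
  where
  decided : ∀ {k} → k ℕ.≤ 3 → True ((+ k) / 4 ℚ.≤? (+ 3) / 4)
  decided ℕ.z≤n                         = _
  decided (ℕ.s≤s ℕ.z≤n)                 = _
  decided (ℕ.s≤s (ℕ.s≤s ℕ.z≤n))         = _
  decided (ℕ.s≤s (ℕ.s≤s (ℕ.s≤s ℕ.z≤n))) = _

claim5p2 : (n : ℕ) (V : Subset n) → IsSubspace V →
    (a₁ a₂ a₃ : F2ⁿ n) (E₁ E₂ E₃ : Subset n) (x₀ x₁ y₀ y₁ : F2ⁿ n) →
    IsBowTie V a₁ a₂ a₃ E₁ E₂ E₃ x₀ x₁ y₀ y₁ →
    (i : Fin n) → lookup x₀ i ≢ lookup x₁ i →
    (f₁ f₂ f₃ : Strategy n) →
    winProb4 i f₁ f₂ f₃ (bowTieDist x₀ x₁ y₀ y₁) ≤ (+ 3) / 4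
claim5p2 n _ _ _ _ _ _ _ _ x₀ x₁ y₀ y₁ (_ , _ , sum≡ , _) i x₀≢x₁ f₁ f₂ f₃ =
  k/4≤3/4 (ℕ.≤-pred (ℕ.≤∧≢⇒< (countWins≤length i f₁ f₂ f₃ qs) someLoss))
  where
  qs : List (Query n)
  qs = bowTieDist x₀ x₁ y₀ y₁
  someLoss : countWins i f₁ f₂ f₃ qs ≢ length qs
  someLoss = bowTie-¬allWin i f₁ f₂ f₃ sum≡ x₀≢x₁ ∘ countWins≡length⇒allWin i f₁ f₂ f₃ qs
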